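{- Let $\Delta$ be a $q$-complex on $\mathbb{F}_q^n$ of dimension $r$ and let $\{U_0\subset U_1\subset\cdots\subset U_r\}$ be a maximal chain in $\Delta$ (so $U_0=\{0\}$ and $\dim U_i=i$). Then $U_k\neq\min_{\prec_q}\{A:\ U_{k-1}\subset A\subset U_{k+1},\ \dim A=k\}$ for all $1\le k<r$ if and only if, for all $1\le k<r$, $U_k$ does not contain the minimum nonzero vector of $U_{k+1}$.
   Context: Let $q$ be a prime power. Fix a total order $\prec$ on $\mathbb{F}_q$ with $0\prec1\prec x$ for all $x\in\mathbb{F}_q\setminus\{0,1\}$, extended lexicographically to $\mathbb{F}_q^n$; minima of sets of vectors are with respect to $\prec$. For distinct subspaces $U,V$ of the same dimension, $U\prec_q V$ iff $\min(U\setminus V)\prec\min(V\setminus U)$. A $q$-complex on $\mathbb{F}_q^n$ is a set of subspaces closed under taking subspaces; its dimension is the maximal dimension of its elements. -}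

module Defs where

open import Data.Nat using (ℕ; zero; suc; _≤_; _<_)
open import Data.Fin using (Fin) renaming (zero to fzero; suc to fsuc; _<_ to _<ᶠ_)
open import Data.Vec using (Vec; []; _∷_; zipWith; map; replicate)
open import Data.Bool using (Bool; true)
open import Data.Product using (Σ; _×_; ∃)
open import Data.Sum using (_⊎_)
open import Relation.Nullary using (¬_)
open import Relation.Binary.PropositionalEquality using (_≡_)
open import Algebra.Structures using (IsCommutativeRing)
open import Function.Bundles using (_⇔_)

-- A finite field of order q = 2 + m, with carrier Fin q, zero = index 0,
-- one = index 1.  The total order ≺ on F_q is the order of indices in Fin q,
-- so 0 ≺ 1 ≺ x for every other x (every pair (field, admissible order) is
-- isomorphic to one of this form).  q is then automatically a prime power.
record FiniteField (m : ℕ) : Set where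
  field
    _+_ _*_ : Fin (suc (suc m)) → Fin (suc (suc m)) → Fin (suc (suc m))
    -_      : Fin (suc (suc m)) → Fin (suc (suc m))
    isCommutativeRing : IsCommutativeRing _≡_ _+_ _*_ -_ fzero (fsuc fzero)
    inverse : ∀ x → ¬ (x ≡ fzero) → ∃ λ y → x * y ≡ fsuc fzero

module Theory {m : ℕ} (F : FiniteField m) (n : ℕ) where
  open FiniteField F

  K : Set
  K = Fin (suc (suc m))

  V : Set
  V = Vec K n

  0v : V
  0v = replicate n fzero

  _+v_ : V → V → V
  _+v_ = zipWith _+_

  _·v_ : K → V → V
  c ·v v = map (c *_) v

  data _≺_ : ∀ {l} → Vec K l → Vec K l → Set where
    here : ∀ {l x y} {xs ys : Vec K l} → x <ᶠ y → (x ∷ xs) ≺ (y ∷ ys)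
    there : ∀ {l x} {xs ys : Vec K l} → xs ≺ ys → (x ∷ xs) ≺ (x ∷ ys)

  _≼_ : V → V → Set
  x ≼ y = x ≺ y ⊎ x ≡ y

  IsMinVec : (V → Set) → V → Set
  IsMinVec P x = P x × (∀ y → P y → x ≼ y)

  record Subspace : Set where
    field
      mem   : V → Bool
      0∈    : mem 0v ≡ true
      +∈    : ∀ u v → mem u ≡ true → mem v ≡ true → mem (u +v v) ≡ true
      ·∈    : ∀ c v → mem v ≡ true → mem (c ·v v) ≡ true

  _∈_ : V → Subspace → Set
  v ∈ U = Subspace.mem U v ≡ true

  _⊆_ : Subspace → Subspace → Set
  U ⊆ W = ∀ v → v ∈ U → v ∈ W

  _≐_ : Subspace → Subspace → Set
  U ≐ W = U ⊆ W × W ⊆ U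

  lincomb : ∀ {k} → Vec K k → Vec V k → V
  lincomb [] [] = 0v
  lincomb (c ∷ cs) (b ∷ bs) = (c ·v b) +v lincomb cs bs

  LinIndep : ∀ {k} → Vec V k → Set
  LinIndep {k} b = ∀ c → lincomb c b ≡ 0v → c ≡ replicate k fzero

  HasDim : Subspace → ℕ → Set
  HasDim U k = Σ (Vec V k) λ b →
    LinIndep b × (∀ v → v ∈ U ⇔ (∃ λ c → lincomb c b ≡ v))

  _≺q_ : Subspace → Subspace → Set
  U ≺q W = Σ V λ x → Σ V λ y →
    IsMinVec (λ v → v ∈ U × ¬ (v ∈ W)) x ×
    IsMinVec (λ v → v ∈ W × ¬ (v ∈ U)) y × x ≺ y

  IsMinQ : (Subspace → Set) → Subspace → Set
  IsMinQ S X = S X × (∀ A → S A → ¬ (A ≐ X) → X ≺q A)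

  Between : Subspace → Subspace → ℕ → Subspace → Set
  Between L H k A = L ⊆ A × A ⊆ H × HasDim A k

  ContainsMinNonzero : Subspace → Subspace → Set
  ContainsMinNonzero U W =
    ∃ λ v → IsMinVec (λ x → x ∈ W × ¬ (x ≡ 0v)) v × v ∈ U

  record QComplex : Set₁ where
    field
      face   : Subspace → Set
      closed : ∀ U W → face U → W ⊆ U → face W

  HasDimension : QComplex → ℕ → Set
  HasDimension Δ r =
    (∃ λ U → QComplex.face Δ U × HasDim U r) ×
    (∀ U k → QComplex.face Δ U → HasDim U k → k ≤ r)

  _∈Δ_ : Subspace → QComplex → Set
  U ∈Δ Δ = QComplex.face Δ U

-- Write v for the ≺-least nonzero vector of U_{k+1}.  If v ∉ U_k, the space
-- A = U_{k-1} + ⟨v⟩ lies between U_{k-1} and U_{k+1} and beats U_k, since v is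
-- the least element of A ∖ U_k while every element of U_k ∖ A is nonzero and
-- hence ≽ v.  If instead v ∈ U_k, let i ≤ k be least with v ∈ U_i; then v is
-- also the least nonzero vector of U_{i+1}, and U_i is the ≺_q-minimum between
-- U_{i-1} and U_{i+1}: the only competitor containing v is U_{i-1} + ⟨v⟩ = U_i,
-- and against any other competitor A the element v wins as min(U_i ∖ A).
-- Dimension is handled by counting: a k-dimensional space over F_q has q^k
-- elements, so it cannot contain k+1 independent vectors.
module Submission where

open import Defs
open import Data.Nat using (ℕ; zero; suc; _≤_; _<_)
open import Relation.Nullary using (¬_)
open import Function.Bundles using (_⇔_)

open import Level using (0ℓ)
open import Algebra.Bundles using (AbelianGroup)
open import Algebra.Structures using (IsCommutativeRing; IsAbelianGroup)
import Algebra.Properties.AbelianGroup as AbelianGroupProperties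
import Algebra.Properties.CommutativeSemigroup as CommutativeSemigroupProperties
open import Data.Bool as Bool using (true)
open import Data.Bool.Properties using (T-≡)
open import Data.Empty using (⊥; ⊥-elim)
open import Data.Fin using (Fin; combine; remQuot)
  renaming (zero to fzero; suc to fsuc; _<_ to _<ᶠ_)
import Data.Fin.Properties as Fin
import Data.Nat as ℕ
import Data.Nat.Properties as ℕ
open import Data.Product using (Σ-syntax; _×_; _,_; proj₁; proj₂; ∃)
open import Data.Sum using (_⊎_; inj₁; inj₂)
open import Data.Vec using (Vec; []; _∷_; zipWith; map; replicate)
import Data.Vec.Properties as Vec
open import Function.Base using (_∘_)
open import Function.Bundles using (mk⇔; Equivalence)
open import Function.Definitions using (Injective)
open import Relation.Nullary using (Dec; yes; no)
open import Relation.Nullary.Decidable using (isYes; map′; toWitness; fromWitness; _×-dec_; ¬?)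
open import Relation.Unary using (Pred; Decidable)
open import Relation.Binary.PropositionalEquality

module Flags {m : ℕ} (F : FiniteField m) (n : ℕ) where
  open FiniteField F
  open Theory F n
  open IsCommutativeRing isCommutativeRing using
    (+-isAbelianGroup; +-identityˡ; +-identityʳ; +-comm; -‿inverseˡ; -‿inverseʳ;
     *-assoc; *-comm; *-identityˡ; distribˡ; distribʳ; zeroˡ; zeroʳ)
  open ≡-Reasoning

  private variable
    k l : ℕ

  _⊕_ : Vec K l → Vec K l → Vec K l
  _⊕_ = zipWith _+_

  ⊖_ : Vec K l → Vec K l
  ⊖_ = map -_

  𝟎 : Vec K l
  𝟎 = replicate _ fzero

  _⊙_ : K → Vec K l → Vec K l
  c ⊙ x = map (c *_) x

  infixl 6 _⊕_
  infixr 7 _⊙_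

  ⊕-isAbelianGroup : IsAbelianGroup _≡_ (_⊕_ {l}) 𝟎 ⊖_
  ⊕-isAbelianGroup = record
    { isGroup = record
      { isMonoid = record
        { isSemigroup = record
          { isMagma = record { isEquivalence = isEquivalence ; ∙-cong = cong₂ _⊕_ }
          ; assoc = Vec.zipWith-assoc (IsAbelianGroup.assoc +-isAbelianGroup)
          }
        ; identity = Vec.zipWith-identityˡ +-identityˡ , Vec.zipWith-identityʳ +-identityʳ
        }
      ; inverse = Vec.zipWith-inverseˡ -‿inverseˡ , Vec.zipWith-inverseʳ -‿inverseʳ
      ; ⁻¹-cong = cong ⊖_
      }
    ; comm = Vec.zipWith-comm +-comm
    }

  ⊕-abelianGroup : ℕ → AbelianGroup 0ℓ 0ℓ
  ⊕-abelianGroup l = record { isAbelianGroup = ⊕-isAbelianGroup {l} }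

  module ⊕-Group {l : ℕ} where
    open AbelianGroup (⊕-abelianGroup l) public using (identityˡ; identityʳ; inverseʳ)
    open AbelianGroupProperties (⊕-abelianGroup l) public
      using (inverseˡ-unique; inverseʳ-unique; x∙y⁻¹≈ε⇒x≈y)
    open CommutativeSemigroupProperties (AbelianGroup.commutativeSemigroup (⊕-abelianGroup l)) public
      using (interchange)

  ⊙-distribˡ : ∀ c (x y : Vec K l) → c ⊙ (x ⊕ y) ≡ c ⊙ x ⊕ c ⊙ y
  ⊙-distribˡ c []       []       = refl
  ⊙-distribˡ c (a ∷ x) (b ∷ y) = cong₂ _∷_ (distribˡ c a b) (⊙-distribˡ c x y)

  ⊙-distribʳ : ∀ c d (x : Vec K l) → (c + d) ⊙ x ≡ c ⊙ x ⊕ d ⊙ x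
  ⊙-distribʳ c d []      = refl
  ⊙-distribʳ c d (a ∷ x) = cong₂ _∷_ (distribʳ a c d) (⊙-distribʳ c d x)

  ⊙-assoc : ∀ c d (x : Vec K l) → (c * d) ⊙ x ≡ c ⊙ d ⊙ x
  ⊙-assoc c d x = trans (Vec.map-cong (*-assoc c d) x) (Vec.map-∘ (c *_) (d *_) x)

  ⊙-identityˡ : (x : Vec K l) → fsuc fzero ⊙ x ≡ x
  ⊙-identityˡ x = trans (Vec.map-cong *-identityˡ x) (Vec.map-id x)

  ⊙-zeroˡ : (x : Vec K l) → fzero ⊙ x ≡ 𝟎
  ⊙-zeroˡ x = trans (Vec.map-cong zeroˡ x) (Vec.map-const x fzero)

  ⊙-zeroʳ : ∀ c → c ⊙ 𝟎 {l} ≡ 𝟎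
  ⊙-zeroʳ {l} c = trans (Vec.map-replicate (c *_) fzero l) (cong (replicate l) (zeroʳ c))

  Generates : Vec V k → Subspace → Set
  Generates b X = ∀ v → v ∈ X ⇔ (∃ λ c → lincomb c b ≡ v)

  lincomb∈ : {b : Vec V k} (X : Subspace) → Generates b X → ∀ c → lincomb c b ∈ X
  lincomb∈ X gen c = Equivalence.from (gen _) (c , refl)

  lincomb-𝟎 : (b : Vec V k) → lincomb 𝟎 b ≡ 0v
  lincomb-𝟎 []      = refl
  lincomb-𝟎 (x ∷ b) = trans (cong₂ _⊕_ (⊙-zeroˡ x) (lincomb-𝟎 b)) (⊕-Group.identityˡ 0v)

  lincomb-⊕ : (c d : Vec K k) (b : Vec V k) → lincomb (c ⊕ d) b ≡ lincomb c b ⊕ lincomb d b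
  lincomb-⊕ []       []       []      = sym (⊕-Group.identityˡ 0v)
  lincomb-⊕ (c ∷ cs) (d ∷ ds) (x ∷ b) = begin
    (c + d) ⊙ x ⊕ lincomb (cs ⊕ ds) b               ≡⟨ cong₂ _⊕_ (⊙-distribʳ c d x) (lincomb-⊕ cs ds b) ⟩
    (c ⊙ x ⊕ d ⊙ x) ⊕ (lincomb cs b ⊕ lincomb ds b) ≡⟨ ⊕-Group.interchange _ _ _ _ ⟩
    (c ⊙ x ⊕ lincomb cs b) ⊕ (d ⊙ x ⊕ lincomb ds b) ∎

  lincomb-⊙ : ∀ a (c : Vec K k) (b : Vec V k) → lincomb (a ⊙ c) b ≡ a ⊙ lincomb c b
  lincomb-⊙ a []       []      = sym (⊙-zeroʳ a)
  lincomb-⊙ a (c ∷ cs) (x ∷ b) = begin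
    (a * c) ⊙ x ⊕ lincomb (a ⊙ cs) b  ≡⟨ cong₂ _⊕_ (⊙-assoc a c x) (lincomb-⊙ a cs b) ⟩
    a ⊙ c ⊙ x ⊕ a ⊙ lincomb cs b      ≡⟨ ⊙-distribˡ a (c ⊙ x) (lincomb cs b) ⟨
    a ⊙ (c ⊙ x ⊕ lincomb cs b)        ∎

  lincomb-⊖ : (c : Vec K k) (b : Vec V k) → lincomb (⊖ c) b ≡ ⊖ lincomb c b
  lincomb-⊖ c b = ⊕-Group.inverseʳ-unique (lincomb c b) (lincomb (⊖ c) b) (begin
    lincomb c b ⊕ lincomb (⊖ c) b ≡⟨ lincomb-⊕ c (⊖ c) b ⟨
    lincomb (c ⊕ ⊖ c) b           ≡⟨ cong (λ d → lincomb d b) (⊕-Group.inverseʳ c) ⟩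
    lincomb 𝟎 b                   ≡⟨ lincomb-𝟎 b ⟩
    0v                            ∎)

  lincomb-head : ∀ v (b : Vec V k) → lincomb (fsuc fzero ∷ 𝟎) (v ∷ b) ≡ v
  lincomb-head v b = begin
    fsuc fzero ⊙ v ⊕ lincomb 𝟎 b   ≡⟨ cong₂ _⊕_ (⊙-identityˡ v) (lincomb-𝟎 b) ⟩
    v ⊕ 0v                         ≡⟨ ⊕-Group.identityʳ v ⟩
    v                              ∎

  lincomb-injective : {b : Vec V k} → LinIndep b → ∀ c d → lincomb c b ≡ lincomb d b → c ≡ d
  lincomb-injective {b = b} indep c d eq = ⊕-Group.x∙y⁻¹≈ε⇒x≈y c d (indep (c ⊕ ⊖ d) (begin
    lincomb (c ⊕ ⊖ d) b             ≡⟨ lincomb-⊕ c (⊖ d) b ⟩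
    lincomb c b ⊕ lincomb (⊖ d) b   ≡⟨ cong₂ _⊕_ eq (lincomb-⊖ d b) ⟩
    lincomb d b ⊕ ⊖ lincomb d b     ≡⟨ ⊕-Group.inverseʳ (lincomb d b) ⟩
    0v                              ∎))

  LinIndep-∷ : {b : Vec V k} (X : Subspace) → LinIndep b → Generates b X →
               ∀ y → ¬ y ∈ X → LinIndep (y ∷ b)
  LinIndep-∷ {b = b} X indep gen y y∉X (c ∷ cs) eq with c Fin.≟ fzero
  ... | yes refl = cong (fzero ∷_) (indep cs (begin
    lincomb cs b                ≡⟨ ⊕-Group.identityˡ (lincomb cs b) ⟨
    𝟎 ⊕ lincomb cs b            ≡⟨ cong (_⊕ lincomb cs b) (⊙-zeroˡ y) ⟨
    fzero ⊙ y ⊕ lincomb cs b    ≡⟨ eq ⟩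
    0v                          ∎))
  ... | no c≢0 =
    ⊥-elim (y∉X (subst (_∈ X) y≡ (Subspace.·∈ X c⁻¹ _ (lincomb∈ X gen (⊖ cs)))))
    where
      c⁻¹ = proj₁ (inverse c c≢0)
      cy≡ : c ⊙ y ≡ lincomb (⊖ cs) b
      cy≡ = trans (⊕-Group.inverseˡ-unique _ _ eq) (sym (lincomb-⊖ cs b))
      y≡ : c⁻¹ ⊙ lincomb (⊖ cs) b ≡ y
      y≡ = begin
        c⁻¹ ⊙ lincomb (⊖ cs) b   ≡⟨ cong (c⁻¹ ⊙_) cy≡ ⟨
        c⁻¹ ⊙ c ⊙ y              ≡⟨ ⊙-assoc c⁻¹ c y ⟨
        (c⁻¹ * c) ⊙ y            ≡⟨ cong (_⊙ y) (trans (*-comm c⁻¹ c) (proj₂ (inverse c c≢0))) ⟩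
        fsuc fzero ⊙ y           ≡⟨ ⊙-identityˡ y ⟩
        y                        ∎

  -- Counting vectors

  q : ℕ
  q = suc (suc m)

  toFin : Vec K l → Fin (q ℕ.^ l)
  toFin []       = fzero
  toFin (x ∷ xs) = combine x (toFin xs)

  fromFin : ∀ l → Fin (q ℕ.^ l) → Vec K l
  fromFin zero    _ = []
  fromFin (suc l) i = let (x , j) = remQuot {q} (q ℕ.^ l) i in x ∷ fromFin l j

  fromFin∘toFin : (x : Vec K l) → fromFin l (toFin x) ≡ x
  fromFin∘toFin []             = refl
  fromFin∘toFin {suc l} (x ∷ xs) =
    cong₂ _∷_ (cong proj₁ split) (trans (cong (fromFin l ∘ proj₂) split) (fromFin∘toFin xs))
    where split = Fin.remQuot-combine {q} {q ℕ.^ l} x (toFin xs)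

  toFin∘fromFin : ∀ l (i : Fin (q ℕ.^ l)) → toFin (fromFin l i) ≡ i
  toFin∘fromFin zero    fzero = refl
  toFin∘fromFin (suc l) i = begin
    combine x (toFin (fromFin l j)) ≡⟨ cong (combine x) (toFin∘fromFin l j) ⟩
    combine x j                     ≡⟨ Fin.combine-remQuot {q} (q ℕ.^ l) i ⟩
    i                               ∎
    where
      x = proj₁ (remQuot {q} (q ℕ.^ l) i)
      j = proj₂ (remQuot {q} (q ℕ.^ l) i)

  toFin-injective : Injective _≡_ _≡_ (toFin {l})
  toFin-injective {l} {x} {y} eq =
    trans (sym (fromFin∘toFin x)) (trans (cong (fromFin l) eq) (fromFin∘toFin y))

  fromFin-injective : ∀ l → Injective _≡_ _≡_ (fromFin l)
  fromFin-injective l {i} {j} eq =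
    trans (sym (toFin∘fromFin l i)) (trans (cong toFin eq) (toFin∘fromFin l j))

  ∃-Vec? : {P : Pred (Vec K l) 0ℓ} → Decidable P → Dec (∃ P)
  ∃-Vec? {P = P} P? = map′ (λ (i , p) → fromFin _ i , p)
    (λ (x , p) → toFin x , subst P (sym (fromFin∘toFin x)) p)
    (Fin.any? (P? ∘ fromFin _))

  Vec-suc↛Vec : (f : Vec K (suc k) → Vec K k) → ¬ Injective _≡_ _≡_ f
  Vec-suc↛Vec {k} f f-inj =
    ℕ.<⇒≱ (ℕ.^-monoʳ-< q (ℕ.s≤s (ℕ.s≤s ℕ.z≤n)) (ℕ.n<1+n k))
          (Fin.injective⇒≤ {f = toFin ∘ f ∘ fromFin (suc k)}
                           (fromFin-injective (suc k) ∘ f-inj ∘ toFin-injective))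

  -- Spans and dimension

  _∈?_ : ∀ v X → Dec (v ∈ X)
  v ∈? X = Subspace.mem X v Bool.≟ true

  isYes-true⇔ : {P : Set} {P? : Dec P} → isYes P? ≡ true ⇔ P
  isYes-true⇔ = mk⇔ (toWitness ∘ Equivalence.from T-≡) (Equivalence.to T-≡ ∘ fromWitness)

  ∈Span? : ∀ (b : Vec V k) v → Dec (∃ λ c → lincomb c b ≡ v)
  ∈Span? b v = ∃-Vec? λ c → Vec.≡-dec Fin._≟_ (lincomb c b) v

  Span : Vec V k → Subspace
  Span b = record
    { mem = λ v → isYes (∈Span? b v)
    ; 0∈  = from (𝟎 , lincomb-𝟎 b)
    ; +∈  = λ u v u∈ v∈ → let (c , c≡) = to u∈ ; (d , d≡) = to v∈ in
              from (c ⊕ d , trans (lincomb-⊕ c d b) (cong₂ _⊕_ c≡ d≡))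
    ; ·∈  = λ a v v∈ → let (c , c≡) = to v∈ in
              from (a ⊙ c , trans (lincomb-⊙ a c b) (cong (a ⊙_) c≡))
    }
    where
      to : ∀ {v} → isYes (∈Span? b v) ≡ true → ∃ λ c → lincomb c b ≡ v
      to = Equivalence.to isYes-true⇔
      from : ∀ {v} → (∃ λ c → lincomb c b ≡ v) → isYes (∈Span? b v) ≡ true
      from = Equivalence.from isYes-true⇔

  Span-generates : (b : Vec V k) → Generates b (Span b)
  Span-generates b v = isYes-true⇔

  HasDim-Span : {b : Vec V k} → LinIndep b → HasDim (Span b) k
  HasDim-Span {b = b} indep = b , indep , Span-generates b

  ∈-Span-∷ : ∀ v (b : Vec V k) → v ∈ Span (v ∷ b)
  ∈-Span-∷ v b = Equivalence.from (Span-generates (v ∷ b) v) (fsuc fzero ∷ 𝟎 , lincomb-head v b)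

  ⊆-Span-∷ : {b : Vec V k} (L : Subspace) → Generates b L → ∀ v → L ⊆ Span (v ∷ b)
  ⊆-Span-∷ {b = b} L gen v x x∈L =
    let (c , c≡) = Equivalence.to (gen x) x∈L in
    Equivalence.from (Span-generates (v ∷ b) x) (fzero ∷ c , (begin
      fzero ⊙ v ⊕ lincomb c b   ≡⟨ cong (_⊕ lincomb c b) (⊙-zeroˡ v) ⟩
      0v ⊕ lincomb c b          ≡⟨ ⊕-Group.identityˡ _ ⟩
      lincomb c b               ≡⟨ c≡ ⟩
      x                         ∎))

  lincomb-∷∈ : {b : Vec V k} (L X : Subspace) → Generates b L → ∀ {v} → v ∈ X → L ⊆ X →
               ∀ c → lincomb c (v ∷ b) ∈ X
  lincomb-∷∈ L X gen {v} v∈X L⊆X (c ∷ cs) =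
    Subspace.+∈ X _ _ (Subspace.·∈ X c v v∈X) (L⊆X _ (lincomb∈ L gen cs))

  Span-∷-⊆ : {b : Vec V k} (L X : Subspace) → Generates b L → ∀ {v} → v ∈ X → L ⊆ X →
             Span (v ∷ b) ⊆ X
  Span-∷-⊆ {b = b} L X gen {v} v∈X L⊆X x x∈ =
    let (c , c≡) = Equivalence.to (Span-generates (v ∷ b) x) x∈ in
    subst (_∈ X) c≡ (lincomb-∷∈ L X gen v∈X L⊆X c)

  ¬LinIndep-suc : (Y : Subspace) → HasDim Y k → (b : Vec V (suc k)) → LinIndep b →
                  (∀ c → lincomb c b ∈ Y) → ⊥
  ¬LinIndep-suc Y (bY , _ , genY) b indep b⊆Y = Vec-suc↛Vec coords coords-injective
    where
      coordinates : ∀ c → ∃ λ d → lincomb d bY ≡ lincomb c b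
      coordinates c = Equivalence.to (genY _) (b⊆Y c)
      coords : Vec K _ → Vec K _
      coords c = proj₁ (coordinates c)
      coords-injective : Injective _≡_ _≡_ coords
      coords-injective {c} {d} eq = lincomb-injective indep c d (begin
        lincomb c b            ≡⟨ proj₂ (coordinates c) ⟨
        lincomb (coords c) bY  ≡⟨ cong (λ e → lincomb e bY) eq ⟩
        lincomb (coords d) bY  ≡⟨ proj₂ (coordinates d) ⟩
        lincomb d b            ∎)

  HasDim-⊆⇒⊇ : (X Y : Subspace) → X ⊆ Y → HasDim X k → HasDim Y k → Y ⊆ X
  HasDim-⊆⇒⊇ X Y X⊆Y (bX , indepX , genX) dimY y y∈Y with y ∈? X
  ... | yes y∈X = y∈X
  ... | no  y∉X = ⊥-elim (¬LinIndep-suc Y dimY (y ∷ bX) (LinIndep-∷ X indepX genX y y∉X)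
                                      (lincomb-∷∈ X Y genX y∈Y X⊆Y))

  HasDim-suc⇒nonzero : (X : Subspace) → HasDim X (suc k) → ∃ λ v → v ∈ X × ¬ v ≡ 0v
  HasDim-suc⇒nonzero X (v ∷ b , indep , gen) =
    v , Equivalence.from (gen v) (fsuc fzero ∷ 𝟎 , lincomb-head v b) ,
    λ v≡0 → 1≢0 (indep _ (trans (lincomb-head v b) v≡0))
    where
      1≢0 : ¬ (fsuc fzero ∷ 𝟎) ≡ 𝟎
      1≢0 ()

  HasDim-zero⇒≡0v : (X : Subspace) → HasDim X 0 → ∀ {v} → v ∈ X → v ≡ 0v
  HasDim-zero⇒≡0v X ([] , _ , gen) v∈X with Equivalence.to (gen _) v∈X
  ... | [] , 0v≡v = sym 0v≡v

  -- Lexicographic minima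

  ≺-irrefl : {x : Vec K l} → ¬ x ≺ x
  ≺-irrefl (here x<x) = ℕ.<-irrefl refl x<x
  ≺-irrefl (there x≺x) = ≺-irrefl x≺x

  ≺-trans : {x y z : Vec K l} → x ≺ y → y ≺ z → x ≺ z
  ≺-trans (here x<y)  (here y<z)  = here (ℕ.<-trans x<y y<z)
  ≺-trans (here x<y)  (there _)   = here x<y
  ≺-trans (there _)   (here y<z)  = here y<z
  ≺-trans (there x≺y) (there y≺z) = there (≺-trans x≺y y≺z)

  ≼-trans : {x y z : V} → x ≼ y → y ≼ z → x ≼ z
  ≼-trans (inj₁ x≺y) (inj₁ y≺z) = inj₁ (≺-trans x≺y y≺z)
  ≼-trans (inj₁ x≺y) (inj₂ refl) = inj₁ x≺y
  ≼-trans (inj₂ refl) y≼z        = y≼z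

  ≺⇒⋡ : {x y : V} → x ≺ y → ¬ y ≼ x
  ≺⇒⋡ x≺y (inj₁ y≺x) = ≺-irrefl (≺-trans x≺y y≺x)
  ≺⇒⋡ x≺y (inj₂ refl) = ≺-irrefl x≺y

  Fin-min : {P : Pred (Fin l) 0ℓ} → Decidable P → ∃ P →
            Σ[ i ∈ Fin l ] P i × (∀ j → P j → i <ᶠ j ⊎ i ≡ j)
  Fin-min {suc l} P? (i , pᵢ) with P? fzero
  ... | yes p₀ = fzero , p₀ , λ { fzero _ → inj₂ refl ; (fsuc _) _ → inj₁ (ℕ.s≤s ℕ.z≤n) }
  Fin-min {suc l} P? (fzero , p₀) | no ¬p₀ = ⊥-elim (¬p₀ p₀)
  Fin-min {suc l} P? (fsuc i , pᵢ) | no ¬p₀ with Fin-min (P? ∘ fsuc) (i , pᵢ)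
  ... | j , pⱼ , least = fsuc j , pⱼ , λ where
        fzero    p₀ → ⊥-elim (¬p₀ p₀)
        (fsuc k) pₖ → suc-mono (least k pₖ)
    where
      suc-mono : ∀ {k} → j <ᶠ k ⊎ j ≡ k → fsuc j <ᶠ fsuc k ⊎ fsuc j ≡ fsuc k
      suc-mono (inj₁ j<k)  = inj₁ (ℕ.s≤s j<k)
      suc-mono (inj₂ refl) = inj₂ refl

  Vec-min : {P : Pred (Vec K l) 0ℓ} → Decidable P → ∃ P →
            Σ[ x ∈ Vec K l ] P x × (∀ y → P y → x ≺ y ⊎ x ≡ y)
  Vec-min {zero}  P? ([] , p) = [] , p , λ { [] _ → inj₂ refl }
  Vec-min {suc l} {P} P? (a ∷ xs , p)
    with h , pₕ , h-least ← Fin-min (λ h → ∃-Vec? (P? ∘ (h ∷_))) (a , xs , p)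
    with t , pₜ , t-least ← Vec-min (P? ∘ (h ∷_)) pₕ
    = h ∷ t , pₜ , least
    where
      least : ∀ y → P y → (h ∷ t) ≺ y ⊎ (h ∷ t) ≡ y
      least (h′ ∷ ys) py with h-least h′ (ys , py)
      ... | inj₁ h<h′ = inj₁ (here h<h′)
      ... | inj₂ refl with t-least ys py
      ...   | inj₁ t≺ys = inj₁ (there t≺ys)
      ...   | inj₂ refl = inj₂ refl

  -- Minimal nonzero vectors and ≺_q-minimal intermediate spaces

  IsMinNonzero : Subspace → V → Set
  IsMinNonzero H = IsMinVec (λ x → x ∈ H × ¬ x ≡ 0v)

  ∉⇒≢0v : ∀ (X : Subspace) {x} → ¬ x ∈ X → ¬ x ≡ 0v
  ∉⇒≢0v X x∉X refl = x∉X (Subspace.0∈ X)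

  _∖?_ : (X Y : Subspace) → Decidable (λ x → x ∈ X × ¬ x ∈ Y)
  (X ∖? Y) x = (x ∈? X) ×-dec ¬? (x ∈? Y)

  minNonzero : (H : Subspace) → HasDim H (suc k) → ∃ (IsMinNonzero H)
  minNonzero H dimH =
    Vec-min (λ x → (x ∈? H) ×-dec ¬? (Vec.≡-dec Fin._≟_ x 0v)) (HasDim-suc⇒nonzero H dimH)

  IsMinNonzero-⊆ : ∀ M H {v} → M ⊆ H → IsMinNonzero H v → v ∈ M → IsMinNonzero M v
  IsMinNonzero-⊆ M H M⊆H ((_ , v≢0) , v-least) v∈M =
    (v∈M , v≢0) , λ y (y∈M , y≢0) → v-least y (M⊆H y y∈M , y≢0)

  module Intermediate (L M H : Subspace) (L⊆M : L ⊆ M) (M⊆H : M ⊆ H) (dimL : HasDim L k)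
                      {v : V} (v-min : IsMinNonzero H v) where
    private
      bL = proj₁ dimL
      genL = proj₂ (proj₂ dimL)
      v∈H = proj₁ (proj₁ v-min)
      v-least = proj₂ v-min

    L+v : Subspace
    L+v = Span (v ∷ bL)

    HasDim-L+v : ¬ v ∈ L → HasDim L+v (suc k)
    HasDim-L+v v∉L = HasDim-Span (LinIndep-∷ L (proj₁ (proj₂ dimL)) genL v v∉L)

    L+v-⊆ : ∀ X → L ⊆ X → v ∈ X → L+v ⊆ X
    L+v-⊆ X L⊆X v∈X = Span-∷-⊆ L X genL v∈X L⊆X

    ≐-L+v : ¬ v ∈ L → ∀ X → L ⊆ X → v ∈ X → HasDim X (suc k) → X ≐ L+v
    ≐-L+v v∉L X L⊆X v∈X dimX =
      HasDim-⊆⇒⊇ L+v X (L+v-⊆ X L⊆X v∈X) (HasDim-L+v v∉L) dimX , L+v-⊆ X L⊆X v∈X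

    v∈L+v : v ∈ L+v
    v∈L+v = ∈-Span-∷ v bL

    L+v-between : ¬ v ∈ L → Between L H (suc k) L+v
    L+v-between v∉L = ⊆-Span-∷ L genL v , L+v-⊆ H (λ x → M⊆H x ∘ L⊆M x) v∈H , HasDim-L+v v∉L

    minNonzero∉⇒¬IsMinQ : ¬ v ∈ M → ¬ IsMinQ (Between L H (suc k)) M
    minNonzero∉⇒¬IsMinQ v∉M (_ , M-least) =
      M⊀L+v (M-least L+v (L+v-between (v∉M ∘ L⊆M v)) (λ (L+v⊆M , _) → v∉M (L+v⊆M v v∈L+v)))
      where
        M⊀L+v : ¬ M ≺q L+v
        M⊀L+v (x , y , ((x∈M , x∉L+v) , _) , (_ , y-least) , x≺y) =
          ≺⇒⋡ x≺y (≼-trans (y-least v (v∈L+v , v∉M))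
                           (v-least x (M⊆H x x∈M , ∉⇒≢0v L+v x∉L+v)))

    minNonzero∈∖⇒IsMinQ : HasDim M (suc k) → v ∈ M → ¬ v ∈ L → IsMinQ (Between L H (suc k)) M
    minNonzero∈∖⇒IsMinQ dimM v∈M v∉L = (L⊆M , M⊆H , dimM) , M-least
      where
        M-least : ∀ A → Between L H (suc k) A → ¬ A ≐ M → M ≺q A
        M-least A (L⊆A , A⊆H , dimA) A≠M with v ∈? A
        ... | yes v∈A = ⊥-elim (A≠M (A⊆M , M⊆A))
          where
            A≐L+v = ≐-L+v v∉L A L⊆A v∈A dimA
            M≐L+v = ≐-L+v v∉L M L⊆M v∈M dimM
            A⊆M : A ⊆ M
            A⊆M x = proj₂ M≐L+v x ∘ proj₁ A≐L+v x
            M⊆A : M ⊆ A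
            M⊆A x = proj₂ A≐L+v x ∘ proj₁ M≐L+v x
        ... | no v∉A with ∃-Vec? (A ∖? M)
        ...   | no A⊆M = ⊥-elim (v∉A (HasDim-⊆⇒⊇ A M A⊆M′ dimA dimM v v∈M))
          where
            A⊆M′ : A ⊆ M
            A⊆M′ x x∈A with x ∈? M
            ... | yes x∈M = x∈M
            ... | no  x∉M = ⊥-elim (A⊆M (x , x∈A , x∉M))
        ...   | yes A∖M≢∅ with y , (y∈A , y∉M) , y-least ← Vec-min (A ∖? M) A∖M≢∅
          = v , y , ((v∈M , v∉A) , v-least-in-M∖A) , ((y∈A , y∉M) , y-least) , v≺y
          where
            v-least-in-M∖A : ∀ z → z ∈ M × ¬ z ∈ A → v ≼ z
            v-least-in-M∖A z (z∈M , z∉A) = v-least z (M⊆H z z∈M , ∉⇒≢0v A z∉A)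
            v≺y : v ≺ y
            v≺y with v-least y (A⊆H y y∈A , ∉⇒≢0v M y∉M)
            ... | inj₁ v≺y = v≺y
            ... | inj₂ refl = ⊥-elim (v∉A y∈A)

  module Flag (r : ℕ) (U : ℕ → Subspace)
              (dim : ∀ i → i ≤ r → HasDim (U i) i)
              (step : ∀ i → i < r → U i ⊆ U (suc i)) where

    IsMinAt : ℕ → Set
    IsMinAt j = IsMinQ (Between (U j) (U (suc (suc j))) (suc j)) (U (suc j))

    module At {j : ℕ} (1+j<r : suc j < r) where
      j<r : j < r
      j<r = ℕ.<-trans (ℕ.n<1+n j) 1+j<r

      dim₁ : HasDim (U (suc j)) (suc j)
      dim₁ = dim (suc j) (ℕ.<⇒≤ 1+j<r)

      open Intermediate (U j) (U (suc j)) (U (suc (suc j)))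
                        (step j j<r) (step (suc j) 1+j<r) (dim j (ℕ.<⇒≤ j<r)) public

    ¬ContainsMinNonzero⇒¬IsMinAt :
      (∀ j → suc j < r → ¬ ContainsMinNonzero (U (suc j)) (U (suc (suc j)))) →
      ∀ j → suc j < r → ¬ IsMinAt j
    ¬ContainsMinNonzero⇒¬IsMinAt ¬contains j 1+j<r =
      let (v , v-min) = minNonzero (U (suc (suc j))) (dim (suc (suc j)) 1+j<r) in
      At.minNonzero∉⇒¬IsMinQ 1+j<r v-min (λ v∈U₁ → ¬contains j 1+j<r (v , v-min , v∈U₁))

    ¬IsMinAt⇒¬ContainsMinNonzero :
      (∀ j → suc j < r → ¬ IsMinAt j) →
      ∀ j → suc j < r → ¬ ContainsMinNonzero (U (suc j)) (U (suc (suc j)))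
    ¬IsMinAt⇒¬ContainsMinNonzero ¬min j 1+j<r (v , v-min , v∈U₁) with v ∈? U j
    ... | no v∉U₀ =
      ¬min j 1+j<r (At.minNonzero∈∖⇒IsMinQ 1+j<r v-min (At.dim₁ 1+j<r) v∈U₁ v∉U₀)
    ¬IsMinAt⇒¬ContainsMinNonzero ¬min zero 1+j<r (v , v-min , v∈U₁) | yes v∈U₀ =
      proj₂ (proj₁ v-min) (HasDim-zero⇒≡0v (U zero) (dim zero ℕ.z≤n) v∈U₀)
    ¬IsMinAt⇒¬ContainsMinNonzero ¬min (suc j) 1+j<r (v , v-min , v∈U₁) | yes v∈U₀ =
      ¬IsMinAt⇒¬ContainsMinNonzero ¬min j (At.j<r 1+j<r) (v , v-min′ , v∈U₀)
      where
        v-min′ : IsMinNonzero (U (suc (suc j))) v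
        v-min′ = IsMinNonzero-⊆ (U (suc (suc j))) (U (suc (suc (suc j))))
                                (step (suc (suc j)) 1+j<r) v-min v∈U₁

corollary4p4 : ∀ {m} (F : FiniteField m) (n r : ℕ)
    (Δ : Theory.QComplex F n) → Theory.HasDimension F n Δ r →
    (U : ℕ → Theory.Subspace F n) →
    (∀ i → i ≤ r → Theory._∈Δ_ F n (U i) Δ) →
    (∀ i → i ≤ r → Theory.HasDim F n (U i) i) →
    (∀ i → i < r → Theory._⊆_ F n (U i) (U (suc i))) →
    ((∀ j → suc j < r →
        ¬ Theory.IsMinQ F n (Theory.Between F n (U j) (U (suc (suc j))) (suc j)) (U (suc j)))
     ⇔
     (∀ j → suc j < r →
        ¬ Theory.ContainsMinNonzero F n (U (suc j)) (U (suc (suc j)))))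
corollary4p4 F n r _ _ U _ dim step =
  mk⇔ ¬IsMinAt⇒¬ContainsMinNonzero ¬ContainsMinNonzero⇒¬IsMinAt
  where open Flags.Flag F n r U dim step
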